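{- For every set $X$ and all $\sigma,\tau\in\Sigma^X$: $[\![\sigma]\!]_X\le[\![\tau]\!]_X$ if and only if $\dot{\textstyle\bigwedge}\{\sigma_x\mathbin{\dot\to}\tau_x:x\in X\}\in\Phi$.
   Context: $\mathsf{P}:\mathbf{Set}^{\mathrm{op}}\to\mathbf{HA}$ is a $\mathbf{Set}$-based tripos: a functor into Heyting algebras such that (1) each $\mathsf{P}f:\mathsf{P}Y\to\mathsf{P}X$ ($f:X\to Y$) has a left adjoint $\exists f$ and right adjoint $\forall f$ among monotone maps $\mathsf{P}X\to\mathsf{P}Y$; (2) for every pullback square in $\mathbf{Set}$ with $f_1:X\to X_1,f_2:X\to X_2,g_1:X_1\to Y,g_2:X_2\to Y$, $\exists f_1\circ\mathsf{P}f_2=\mathsf{P}g_1\circ\exists g_2$ and $\forall f_1\circ\mathsf{P}f_2=\mathsf{P}g_1\circ\forall g_2$; (3) there is a set $\Sigma$ and $\mathrm{tr}_\Sigma\in\mathsf{P}\Sigma$ with $\sigma\mapsto\mathsf{P}\sigma(\mathrm{tr}_\Sigma)$, $\Sigma^X\to\mathsf{P}X$, surjective for every set $X$. Fix these; write $[\![\sigma]\!]_X:=\mathsf{P}\sigma(\mathrm{tr}_\Sigma)$ for $\sigma\in\Sigma^X$. Let $\pi,\pi'$ be the projections $\Sigma\times\Sigma\to\Sigma$ and $\dot\to:\Sigma\times\Sigma\to\Sigma$ (infix) any map with $[\![\dot\to]\!]_{\Sigma\times\Sigma}=[\![\pi]\!]_{\Sigma\times\Sigma}\to[\![\pi']\!]_{\Sigma\times\Sigma}$.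 Let $E=\{(\xi,s)\in\Sigma\times\mathfrak{P}(\Sigma):\xi\in s\}$ with projections $e_1,e_2$, and $\dot\bigwedge:\mathfrak{P}(\Sigma)\to\Sigma$ any map with $[\![\dot\bigwedge]\!]_{\mathfrak{P}(\Sigma)}=\forall e_2([\![e_1]\!]_E)$. Let $1$ be a singleton, $\top_1$ the top of $\mathsf{P}1$, and $\Phi=\{\xi\in\Sigma:[\![\xi]\!]_{\_\in1}=\top_1\}$, where $[\![\xi]\!]_{\_\in1}$ is the decoding of the constant family on $1$ with value $\xi$. The axiom of choice is assumed. -}

module Defs where

open import Level using (Level; _⊔_; Setω)
open import Data.Product using (Σ-syntax; ∃-syntax; _×_; _,_; proj₁; proj₂)
open import Data.Unit using (⊤; tt)
open import Relation.Binary.PropositionalEquality using (_≡_)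
open import Relation.Binary.Lattice.Bundles using (HeytingAlgebra)
open import Function.Bundles using (_⇔_)

-- Sets of the paper are modelled by Agda types (at every universe level);
-- functions are Agda functions (considered up to pointwise equality).

record IsPullback {a b c d : Level} {X : Set a} {X₁ : Set b} {X₂ : Set c} {Y : Set d}
                  (f₁ : X → X₁) (f₂ : X → X₂) (g₁ : X₁ → Y) (g₂ : X₂ → Y)
                  : Set (a ⊔ b ⊔ c ⊔ d) where
  field
    commutes  : ∀ x → g₁ (f₁ x) ≡ g₂ (f₂ x)
    existence : ∀ x₁ x₂ → g₁ x₁ ≡ g₂ x₂ → ∃[ x ] (f₁ x ≡ x₁ × f₂ x ≡ x₂)
    unique    : ∀ x x′ → f₁ x ≡ f₁ x′ → f₂ x ≡ f₂ x′ → x ≡ x′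

record Tripos (s c : Level) : Setω where
  field
    P : ∀ {a} → Set a → HeytingAlgebra (a ⊔ c) (a ⊔ c) (a ⊔ c)

  module H {a} (X : Set a) = HeytingAlgebra (P X)

  field
    P₁ : ∀ {a b} {X : Set a} {Y : Set b} → (X → Y) → H.Carrier Y → H.Carrier X
    P₁-cong : ∀ {a b} {X : Set a} {Y : Set b} (f : X → Y) {φ ψ : H.Carrier Y} →
              H._≈_ Y φ ψ → H._≈_ X (P₁ f φ) (P₁ f ψ)
    P₁-ext  : ∀ {a b} {X : Set a} {Y : Set b} (f g : X → Y) → (∀ x → f x ≡ g x) →
              ∀ φ → H._≈_ X (P₁ f φ) (P₁ g φ)
    P₁-id   : ∀ {a} {X : Set a} φ → H._≈_ X (P₁ (λ (x : X) → x) φ) φ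
    P₁-∘    : ∀ {a b d} {X : Set a} {Y : Set b} {Z : Set d} (f : X → Y) (g : Y → Z) φ →
              H._≈_ X (P₁ (λ x → g (f x)) φ) (P₁ f (P₁ g φ))
    P₁-⊤ : ∀ {a b} {X : Set a} {Y : Set b} (f : X → Y) →
           H._≈_ X (P₁ f (H.⊤ Y)) (H.⊤ X)
    P₁-⊥ : ∀ {a b} {X : Set a} {Y : Set b} (f : X → Y) →
           H._≈_ X (P₁ f (H.⊥ Y)) (H.⊥ X)
    P₁-∧ : ∀ {a b} {X : Set a} {Y : Set b} (f : X → Y) φ ψ →
           H._≈_ X (P₁ f (H._∧_ Y φ ψ)) (H._∧_ X (P₁ f φ) (P₁ f ψ))
    P₁-∨ : ∀ {a b} {X : Set a} {Y : Set b} (f : X → Y) φ ψ →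
           H._≈_ X (P₁ f (H._∨_ Y φ ψ)) (H._∨_ X (P₁ f φ) (P₁ f ψ))
    P₁-⇨ : ∀ {a b} {X : Set a} {Y : Set b} (f : X → Y) φ ψ →
           H._≈_ X (P₁ f (H._⇨_ Y φ ψ)) (H._⇨_ X (P₁ f φ) (P₁ f ψ))

    ∃f : ∀ {a b} {X : Set a} {Y : Set b} → (X → Y) → H.Carrier X → H.Carrier Y
    ∀f : ∀ {a b} {X : Set a} {Y : Set b} → (X → Y) → H.Carrier X → H.Carrier Y
    ∃f-mono : ∀ {a b} {X : Set a} {Y : Set b} (f : X → Y) {φ ψ} →
              H._≤_ X φ ψ → H._≤_ Y (∃f f φ) (∃f f ψ)
    ∀f-mono : ∀ {a b} {X : Set a} {Y : Set b} (f : X → Y) {φ ψ} →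
              H._≤_ X φ ψ → H._≤_ Y (∀f f φ) (∀f f ψ)
    ∃⊣P : ∀ {a b} {X : Set a} {Y : Set b} (f : X → Y) φ ψ →
          H._≤_ Y (∃f f φ) ψ ⇔ H._≤_ X φ (P₁ f ψ)
    P⊣∀ : ∀ {a b} {X : Set a} {Y : Set b} (f : X → Y) ψ φ →
          H._≤_ X (P₁ f ψ) φ ⇔ H._≤_ Y ψ (∀f f φ)

    BC-∃ : ∀ {a b d e} {X : Set a} {X₁ : Set b} {X₂ : Set d} {Y : Set e}
             (f₁ : X → X₁) (f₂ : X → X₂) (g₁ : X₁ → Y) (g₂ : X₂ → Y) →
             IsPullback f₁ f₂ g₁ g₂ →
             ∀ φ → H._≈_ X₁ (∃f f₁ (P₁ f₂ φ)) (P₁ g₁ (∃f g₂ φ))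
    BC-∀ : ∀ {a b d e} {X : Set a} {X₁ : Set b} {X₂ : Set d} {Y : Set e}
             (f₁ : X → X₁) (f₂ : X → X₂) (g₁ : X₁ → Y) (g₂ : X₂ → Y) →
             IsPullback f₁ f₂ g₁ g₂ →
             ∀ φ → H._≈_ X₁ (∀f f₁ (P₁ f₂ φ)) (P₁ g₁ (∀f g₂ φ))

    Sig : Set s
    tr  : H.Carrier Sig
    generic : ∀ {a} (X : Set a) (φ : H.Carrier X) →
              ∃[ σ ] H._≈_ X (P₁ σ tr) φ

  ⟦_⟧ : ∀ {a} {X : Set a} → (X → Sig) → H.Carrier X
  ⟦ σ ⟧ = P₁ σ tr

  π π′ : Sig × Sig → Sig
  π  = proj₁
  π′ = proj₂

  IsImpl : (Sig × Sig → Sig) → Set (s ⊔ c)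
  IsImpl imp = H._≈_ (Sig × Sig) ⟦ imp ⟧ (H._⇨_ (Sig × Sig) ⟦ π ⟧ ⟦ π′ ⟧)

  𝔓 : (q : Level) → Set (s ⊔ Level.suc q)
  𝔓 q = Sig → Set q

  E : (q : Level) → Set (s ⊔ Level.suc q)
  E q = Σ[ p ∈ Sig × 𝔓 q ] proj₂ p (proj₁ p)

  e₁ : ∀ {q} → E q → Sig
  e₁ ((ξ , S) , _) = ξ

  e₂ : ∀ {q} → E q → 𝔓 q
  e₂ ((ξ , S) , _) = S

  IsBigMeet : ∀ {q} → (𝔓 q → Sig) → Set (s ⊔ Level.suc q ⊔ c)
  IsBigMeet {q} meet = H._≈_ (𝔓 q) ⟦ meet ⟧ (∀f e₂ ⟦ e₁ {q} ⟧)

  Φ : Sig → Set c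
  Φ ξ = H._≈_ ⊤ ⟦ (λ (_ : ⊤) → ξ) ⟧ (H.⊤ ⊤)

  imageOf : ∀ {x} {X : Set x} (imp : Sig × Sig → Sig) (σ τ : X → Sig) → 𝔓 (x ⊔ s)
  imageOf {X = X} imp σ τ ξ = ∃[ y ] (imp (σ y , τ y) ≡ ξ)

-- Decoding a family of truth values into P X is reindexing of the generic predicate,
-- so ⟦ σ ⟧ ≤ ⟦ τ ⟧ holds iff the family y ↦ σ y →̇ τ y is valid on X.  Validity of a
-- family only depends on its image S ⊆ Σ, as validity is stable under reindexing.
-- Finally, by Beck–Chevalley for the pullback of E ⟶ 𝔓(Σ) along the point S, the
-- decoding of ⋀̇ S in P 1 is the universal quantification over S of the generic
-- predicate, which is ⊤ exactly when the generic predicate is valid on S.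
module Submission where

open import Defs
open import Level using (Level; _⊔_)
open import Data.Product using (Σ; _×_; _,_; proj₁; ∃-syntax)
open import Data.Unit using (tt) renaming (⊤ to 𝟙)
open import Function.Bundles using (_⇔_; mk⇔; Equivalence)
open import Function.Properties.Equivalence using () renaming (sym to ⇔-sym; trans to ⇔-trans)
open import Relation.Binary.PropositionalEquality using (_≡_; refl)
open import Relation.Binary.Lattice.Bundles using (HeytingAlgebra)
import Relation.Binary.Lattice.Properties.HeytingAlgebra as HeytingAlgebraProperties
import Relation.Binary.Reasoning.Setoid as SetoidReasoning

module _ {c ℓ₁ ℓ₂} (A : HeytingAlgebra c ℓ₁ ℓ₂) where
  open HeytingAlgebra A hiding (refl)

  ⊤≤⇔≈⊤ : ∀ {u} → ⊤ ≤ u ⇔ u ≈ ⊤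
  ⊤≤⇔≈⊤ {u} = mk⇔ (antisym (maximum u)) (λ u≈⊤ → reflexive (Eq.sym u≈⊤))

  ≤⇔⊤≤⇨ : ∀ {u v} → u ≤ v ⇔ ⊤ ≤ u ⇨ v
  ≤⇔⊤≤⇨ {u} {v} = mk⇔
    (λ u≤v → transpose-⇨ (trans (x∧y≤y ⊤ u) u≤v))
    (λ ⊤≤u⇨v → trans (∧-greatest (maximum u) (reflexive Eq.refl)) (transpose-∧ ⊤≤u⇨v))

module TriposLogic {s c : Level} (T : Tripos s c) where
  open Tripos T

  Valid : ∀ {a} {X : Set a} → H.Carrier X → Set (a ⊔ c)
  Valid {X = X} φ = H._≤_ X (H.⊤ X) φ

  valid-resp-≈ : ∀ {a} {X : Set a} {φ ψ : H.Carrier X} → H._≈_ X φ ψ → Valid φ ⇔ Valid ψ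
  valid-resp-≈ {X = X} φ≈ψ = mk⇔
    (λ ⊤≤φ → H.trans X ⊤≤φ (H.reflexive X φ≈ψ))
    (λ ⊤≤ψ → H.trans X ⊤≤ψ (H.reflexive X (H.Eq.sym X φ≈ψ)))

  P₁-mono : ∀ {a b} {X : Set a} {Y : Set b} (f : X → Y) {φ ψ : H.Carrier Y} →
            H._≤_ Y φ ψ → H._≤_ X (P₁ f φ) (P₁ f ψ)
  P₁-mono f {φ} {ψ} φ≤ψ = Equivalence.to (∃⊣P f (P₁ f φ) ψ)
    (H.trans _ (Equivalence.from (∃⊣P f (P₁ f φ) φ) (H.refl _)) φ≤ψ)

  valid-P₁ : ∀ {a b} {X : Set a} {Y : Set b} (f : X → Y) {φ : H.Carrier Y} →
             Valid φ → Valid (P₁ f φ)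
  valid-P₁ {X = X} f ⊤≤φ = H.trans X (H.reflexive X (H.Eq.sym X (P₁-⊤ f))) (P₁-mono f ⊤≤φ)

  valid-∀f : ∀ {a b} {X : Set a} {Y : Set b} (f : X → Y) {φ : H.Carrier X} →
             Valid (∀f f φ) ⇔ Valid φ
  valid-∀f {X = X} f {φ} = ⇔-trans (⇔-sym (P⊣∀ f (H.⊤ _) φ)) (mk⇔
    (H.trans X (H.reflexive X (H.Eq.sym X (P₁-⊤ f))))
    (H.trans X (H.reflexive X (P₁-⊤ f))))

  valid-⟦⟧-∘ : ∀ {a b} {X : Set a} {Y : Set b} (f : X → Y) (ξ : Y → Sig) →
               Valid ⟦ ξ ⟧ → Valid ⟦ (λ x → ξ (f x)) ⟧
  valid-⟦⟧-∘ f ξ ⊤≤ξ =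
    Equivalence.from (valid-resp-≈ (P₁-∘ f ξ tr)) (valid-P₁ f ⊤≤ξ)

  ⟦⟧-imp : ∀ {a} {X : Set a} {imp : Sig × Sig → Sig} → IsImpl imp → (σ τ : X → Sig) →
           H._≈_ X ⟦ (λ y → imp (σ y , τ y)) ⟧ (H._⇨_ X ⟦ σ ⟧ ⟦ τ ⟧)
  ⟦⟧-imp {X = X} {imp} isImp σ τ = begin
    ⟦ (λ y → imp (⟨σ,τ⟩ y)) ⟧            ≈⟨ P₁-∘ ⟨σ,τ⟩ imp tr ⟩
    P₁ ⟨σ,τ⟩ ⟦ imp ⟧                     ≈⟨ P₁-cong ⟨σ,τ⟩ isImp ⟩
    P₁ ⟨σ,τ⟩ (H._⇨_ _ ⟦ π ⟧ ⟦ π′ ⟧)      ≈⟨ P₁-⇨ ⟨σ,τ⟩ ⟦ π ⟧ ⟦ π′ ⟧ ⟩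
    P₁ ⟨σ,τ⟩ ⟦ π ⟧ ⇨ P₁ ⟨σ,τ⟩ ⟦ π′ ⟧     ≈⟨ ⇨-cong (P₁-∘ ⟨σ,τ⟩ π tr) (P₁-∘ ⟨σ,τ⟩ π′ tr) ⟨
    ⟦ σ ⟧ ⇨ ⟦ τ ⟧                        ∎
    where
    open H X using (_⇨_)
    open HeytingAlgebraProperties (P X) using (⇨-cong)
    open SetoidReasoning (H.setoid X)
    ⟨σ,τ⟩ : X → Sig × Sig
    ⟨σ,τ⟩ y = σ y , τ y

  image : ∀ {x} {X : Set x} → (X → Sig) → 𝔓 (x ⊔ s)
  image ι ξ = ∃[ y ] (ι y ≡ ξ)

  valid⇔valid-on-image : ∀ {x} {X : Set x} (ι : X → Sig) →
                         Valid ⟦ ι ⟧ ⇔ Valid ⟦ proj₁ {B = image ι} ⟧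
  valid⇔valid-on-image {X = X} ι = mk⇔
    (λ ⊤≤ι → Equivalence.from (valid-resp-≈ (P₁-ext proj₁ (λ w → ι (source w)) proj₁≡ι∘source tr))
               (valid-⟦⟧-∘ source ι ⊤≤ι))
    (valid-⟦⟧-∘ (λ y → ι y , y , refl) proj₁)
    where
    source : Σ Sig (image ι) → X
    source (_ , y , _) = y
    proj₁≡ι∘source : ∀ w → proj₁ w ≡ ι (source w)
    proj₁≡ι∘source (_ , _ , refl) = refl

  module _ {q : Level} (S : 𝔓 q) where

    membership : Σ Sig S → E q
    membership (ξ , ξ∈S) = (ξ , S) , ξ∈S

    ∈-pullback : IsPullback (λ (_ : Σ Sig S) → tt) membership (λ (_ : 𝟙) → S) e₂
    ∈-pullback = record
      { commutes  = λ _ → refl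
      ; existence = existence
      ; unique    = unique
      }
      where
      existence : ∀ t e → S ≡ e₂ e → ∃[ w ] (tt ≡ t × membership w ≡ e)
      existence tt ((ξ , .S) , ξ∈S) refl = (ξ , ξ∈S) , refl , refl
      unique : ∀ w w′ → tt ≡ tt → membership w ≡ membership w′ → w ≡ w′
      unique _ _ _ refl = refl

  Φ-meet⇔valid : ∀ {q} {meet : 𝔓 q → Sig} → IsBigMeet meet → (S : 𝔓 q) →
                 Φ (meet S) ⇔ Valid ⟦ proj₁ {B = S} ⟧
  Φ-meet⇔valid {q} {meet} isMeet S =
    ⇔-trans (⇔-sym (⊤≤⇔≈⊤ (P 𝟙)))
      (⇔-trans (valid-resp-≈ ⟦meet-S⟧≈∀-members)
        (⇔-trans (valid-∀f (λ _ → tt))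
          (valid-resp-≈ (H.Eq.sym _ (P₁-∘ (membership S) e₁ tr)))))
    where
    open SetoidReasoning (H.setoid 𝟙)
    point : 𝟙 → 𝔓 q
    point _ = S
    ⟦meet-S⟧≈∀-members : H._≈_ 𝟙 ⟦ (λ (_ : 𝟙) → meet S) ⟧
                                  (∀f (λ _ → tt) (P₁ (membership S) ⟦ e₁ ⟧))
    ⟦meet-S⟧≈∀-members = begin
      ⟦ (λ _ → meet S) ⟧                      ≈⟨ P₁-∘ point meet tr ⟩
      P₁ point ⟦ meet ⟧                       ≈⟨ P₁-cong point isMeet ⟩
      P₁ point (∀f e₂ ⟦ e₁ ⟧)                 ≈⟨ BC-∀ _ _ _ _ (∈-pullback S) ⟦ e₁ ⟧ ⟨
      ∀f (λ _ → tt) (P₁ (membership S) ⟦ e₁ ⟧) ∎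

proposition2p7 : ∀ {s c : Level} (T : Tripos s c) → let open Tripos T in
    (imp : Sig × Sig → Sig) → IsImpl imp →
    ∀ {x : Level} (meet : 𝔓 (x ⊔ s) → Sig) → IsBigMeet meet →
    (X : Set x) (σ τ : X → Sig) →
    (H._≤_ X ⟦ σ ⟧ ⟦ τ ⟧ ⇔ Φ (meet (imageOf imp σ τ)))
proposition2p7 T imp isImp meet isMeet X σ τ =
  ⇔-trans (≤⇔⊤≤⇨ (P X))
    (⇔-trans (valid-resp-≈ (H.Eq.sym X (⟦⟧-imp isImp σ τ)))
      (⇔-trans (valid⇔valid-on-image (λ y → imp (σ y , τ y)))
        (⇔-sym (Φ-meet⇔valid isMeet (imageOf imp σ τ)))))
  where
  open Tripos T
  open TriposLogic T
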